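{- Let $G=(U,V,E)$ be a finite bipartite graph and $p,q$ positive integers. Consider the procedure NPC described in the context, equipped with the minimum non-neighbor candidate partition rule. Then a call NPC$(C_U,C_V,P_U,P_V,H_U,H_V)$ (including all of its recursive calls) runs in time $O(2^{n'/2})$, where $n'=|C_U|+|C_V|$.
   Context: $N(x)$ denotes the neighbours of $x$; binomials satisfy $\binom{n}{k}=0$ if $k<0$ or $k>n$. Cost model: arithmetic and binomial-coefficient evaluations take constant time, so the non-recursive work of a call (including finding node-pivots) is $O(n'^2)$. Procedure NPC$(C_U,C_V,P_U,P_V,H_U,H_V)$ (with $C_U,P_U,H_U\subseteq U$, $C_V,P_V,H_V\subseteq V$) updates a global counter $cnt$: (1) If there is no edge between $C_U$ and $C_V$, or $|H_U|=p$, or $|H_V|=q$: set $c_0=|C_U|,c_1=|C_V|,p_0=|P_U|,p_1=|P_V|,h_0=|H_U|,h_1=|H_V|$; if $c_0=0$ or $c_1=0$ add $\binom{p_0+c_0}{p-h_0}\binom{p_1+c_1}{q-h_1}$ to $cnt$, otherwise add $\binom{p_0+c_0}{p-h_0}\binom{p_1}{q-h_1}+\binom{p_0}{p-h_0}\binom{p_1+c_1}{q-h_1}-\binom{p_0}{p-h_0}\binom{p_1}{q-h_1}$; return. (2) Move every node of $C_U$ adjacent to all of $C_V$ into $P_U$; then move every node of $C_V$ adjacent to all of the updated $C_U$ into $P_V$. (3) Choose $L_U,L_V$ by the minimum non-neighbor candidate partition: let $w\in C_U\cup C_V$ minimize $\min(|C_U\setminus N(w)|,|C_V\setminus N(w)|)$;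 if $|C_U\setminus N(w)|\le|C_V\setminus N(w)|$ set $L_U=C_U\setminus N(w)$, $L_V=\emptyset$, else set $L_U=\emptyset$, $L_V=C_V\setminus N(w)$. (4) For each $u\in L_U$ in turn: $C_U\gets C_U\setminus\{u\}$, call NPC$(C_U,C_V\cap N(u),P_U,P_V,H_U\cup\{u\},H_V)$. (5) For each $v\in L_V$ in turn: $C_V\gets C_V\setminus\{v\}$, call NPC$(C_U\cap N(v),C_V,P_U,P_V,H_U,H_V\cup\{v\})$. (6) Call NPC$(C_U,C_V,P_U,P_V,H_U,H_V)$ with the current sets. -}

module Defs where

open import Data.Nat using (ℕ; zero; suc; _+_; _*_; _≤_; _⊓_; _≤ᵇ_)
open import Data.Bool using (Bool; true; false; not; _∧_; _∨_; if_then_else_)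
open import Data.Fin using (Fin)
open import Data.Fin.Subset using (Subset; ⊥; ⁅_⁆; _∈_; _∩_; _∪_; _─_; _-_; ∣_∣)
open import Data.Vec using (Vec; []; _∷_; tabulate; lookup)
open import Data.Sum using (_⊎_; inj₁; inj₂)
open import Data.Product using (_×_)
open import Data.List using (List; []; _∷_)
open import Data.List.Membership.Propositional using () renaming (_∈_ to _∈ₗ_)
open import Data.List.Relation.Unary.Unique.Propositional using (Unique)
open import Relation.Binary.PropositionalEquality using (_≡_)
open import Relation.Nullary using (¬_)
open import Function.Bundles using (_⇔_)

-- A finite bipartite graph G = (U, V, E) with U = Fin m, V = Fin k;
-- adj u v = true iff {u,v} ∈ E.  (No U–U or V–V edges by construction.)
record BipGraph (m k : ℕ) : Set where
  field
    adj : Fin m → Fin k → Bool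
open BipGraph public

subᵇ : ∀ {n} → Subset n → Subset n → Bool
subᵇ []       []       = true
subᵇ (x ∷ xs) (y ∷ ys) = (not x ∨ y) ∧ subᵇ xs ys

record State (m k : ℕ) : Set where
  constructor st
  field
    CU : Subset m
    CV : Subset k
    PU : Subset m
    PV : Subset k
    HU : Subset m
    HV : Subset k
open State public

size : ∀ {m k} → State m k → ℕ
size s = ∣ CU s ∣ + ∣ CV s ∣

-- Cost model: non-recursive work of a call is (up to a constant) n'^2;
-- we charge n'^2 + 1 per call (the +1 so that every call costs ≥ 1).
work : ∀ {m k} → State m k → ℕ
work s = suc (size s * size s)

Vertex : ℕ → ℕ → Set
Vertex m k = Fin m ⊎ Fin k

module _ {m k : ℕ} (G : BipGraph m k) (p q : ℕ) where

  NbV : Fin m → Subset k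
  NbV u = tabulate (adj G u)

  NbU : Fin k → Subset m
  NbU v = tabulate (λ u → adj G u v)

  nbrU : Vertex m k → Subset m
  nbrU (inj₁ u) = ⊥
  nbrU (inj₂ v) = NbU v

  nbrV : Vertex m k → Subset k
  nbrV (inj₁ u) = NbV u
  nbrV (inj₂ v) = ⊥

  -- Step (1): termination condition
  NoEdge : Subset m → Subset k → Set
  NoEdge A B = ∀ u v → u ∈ A → v ∈ B → adj G u v ≡ false

  Stop : State m k → Set
  Stop s = NoEdge (CU s) (CV s) ⊎ (∣ HU s ∣ ≡ p ⊎ ∣ HV s ∣ ≡ q)

  -- Step (2): move nodes of C_U adjacent to all of C_V into P_U, then
  -- nodes of C_V adjacent to all of the updated C_U into P_V.
  step2 : State m k → State m k
  step2 (st cu cv pu pv hu hv) =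
    let mvU  = tabulate (λ u → lookup cu u ∧ subᵇ cv (NbV u))
        cu'  = cu ─ mvU
        mvV  = tabulate (λ v → lookup cv v ∧ subᵇ cu' (NbU v))
    in st cu' (cv ─ mvV) (pu ∪ mvU) (pv ∪ mvV) hu hv

  -- Step (3): minimum non-neighbor candidate partition
  InC : State m k → Vertex m k → Set
  InC s (inj₁ u) = u ∈ CU s
  InC s (inj₂ v) = v ∈ CV s

  nonU : State m k → Vertex m k → Subset m
  nonU s w = CU s ─ nbrU w

  nonV : State m k → Vertex m k → Subset k
  nonV s w = CV s ─ nbrV w

  key : State m k → Vertex m k → ℕ
  key s w = ∣ nonU s w ∣ ⊓ ∣ nonV s w ∣

  LUof : State m k → Vertex m k → Subset m
  LUof s w = if ∣ nonU s w ∣ ≤ᵇ ∣ nonV s w ∣ then nonU s w else ⊥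

  LVof : State m k → Vertex m k → Subset k
  LVof s w = if ∣ nonU s w ∣ ≤ᵇ ∣ nonV s w ∣ then ⊥ else nonV s w

  -- Partition s L_U L_V : (L_U, L_V) is a possible outcome of step (3)
  -- (any minimizer w may be chosen; if C_U ∪ C_V is empty, L_U = L_V = ∅).
  data Partition (s : State m k) : Subset m → Subset k → Set where
    none : (∀ w → ¬ InC s w) → Partition s ⊥ ⊥
    pick : (w : Vertex m k) → InC s w →
           (∀ w' → InC s w' → key s w ≤ key s w') →
           Partition s (LUof s w) (LVof s w)

  -- a list enumerating the elements of a subset, each exactly once
  -- (the order of "for each u in L in turn" is arbitrary)
  Enumerates : ∀ {n} → List (Fin n) → Subset n → Set
  Enumerates xs A = Unique xs × (∀ x → (x ∈ₗ xs) ⇔ (x ∈ A))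

  -- Run s t : the call NPC(s) (with all its recursive calls) can execute
  -- with total cost t (sum over all calls in the recursion tree of work).
  -- LoopU s us s' t : step (4) over the list us, starting in s, ending in s'.
  -- LoopV s vs s' t : step (5) likewise.
  data Run : State m k → ℕ → Set
  data LoopU : State m k → List (Fin m) → State m k → ℕ → Set
  data LoopV : State m k → List (Fin k) → State m k → ℕ → Set

  data Run where
    leaf : ∀ {s} → Stop s → Run s (work s)
    node : ∀ {s LU LV ordU ordV s3 s4 t1 t2 t3} →
           ¬ Stop s →
           Partition (step2 s) LU LV →
           Enumerates ordU LU → Enumerates ordV LV →
           LoopU (step2 s) ordU s3 t1 →
           LoopV s3 ordV s4 t2 →
           Run s4 t3 →
           Run s (work s + t1 + t2 + t3)

  data LoopU where
    []  : ∀ {s} → LoopU s [] s 0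
    _∷_ : ∀ {s u us s' t t'} →
          Run (st (CU s - u) (CV s ∩ NbV u) (PU s) (PV s) (HU s ∪ ⁅ u ⁆) (HV s)) t →
          LoopU (st (CU s - u) (CV s) (PU s) (PV s) (HU s) (HV s)) us s' t' →
          LoopU s (u ∷ us) s' (t + t')

  data LoopV where
    []  : ∀ {s} → LoopV s [] s 0
    _∷_ : ∀ {s v vs s' t t'} →
          Run (st (CU s ∩ NbU v) (CV s - v) (PU s) (PV s) (HU s) (HV s ∪ ⁅ v ⁆)) t →
          LoopV (st (CU s) (CV s - v) (PU s) (PV s) (HU s) (HV s)) vs s' t' →
          LoopV s (v ∷ vs) s' (t + t')

module Submission where

open import Defs
open import Data.Nat using (ℕ; zero; suc; _+_; _*_; _∸_; _^_; _≤_; _<_; _≤ᵇ_; z≤n; s≤s; ⌈_/2⌉)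
import Data.Nat as Nat
open import Data.Nat.Properties
open import Data.Nat.Tactic.RingSolver using (solve-∀)
open import Data.Bool using (Bool; true; false; T; _∧_)
import Data.Bool as Bool
open import Data.Bool.Properties using (¬-not; not-¬)
open import Data.Fin using (Fin; zero; suc)
open import Data.Fin.Properties using (all?)
open import Data.Fin.Subset
open import Data.Fin.Subset.Properties
open import Data.Vec using ([]; _∷_; here; there; tabulate; lookup)
open import Data.Vec.Properties using ([]=⇒lookup; lookup⇒[]=; lookup∘tabulate)
open import Data.Product using (∃-syntax; _×_; _,_; proj₁; proj₂)
open import Data.Sum using (_⊎_; inj₁; inj₂)
open import Data.Empty using (⊥-elim)
open import Data.List using (List; []; _∷_; length; foldl; map; _++_; filter; allFin)
open import Data.List.Membership.Propositional using () renaming (_∈_ to _∈ₗ_)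
open import Data.List.Membership.Propositional.Properties
  using (∈-filter⁺; ∈-filter⁻; ∈-allFin; ∈-map⁺; ∈-map⁻; ∈-++⁺ˡ; ∈-++⁺ʳ; ∈-++⁻; ∈-length)
open import Data.List.Relation.Unary.Any using (here; there)
open import Data.List.Relation.Unary.Any.Properties using (¬Any[])
import Data.List.Relation.Unary.All as All
open import Data.List.Relation.Unary.AllPairs using (_∷_)
open import Data.List.Relation.Unary.Unique.Propositional using (Unique)
open import Data.List.Relation.Unary.Unique.Propositional.Properties using (filter⁺; allFin⁺)
open import Data.List.Extrema ≤-totalOrder using (argmin; argmin-sel; f[argmin]≤f[⊤]; f[argmin]≤f[xs])
open import Function using (_∘_)
open import Function.Bundles using (Equivalence; mk⇔)
open import Relation.Binary.PropositionalEquality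
open import Relation.Nullary using (¬_; Dec; yes; no; contradiction)
open import Relation.Nullary.Decidable using (_→-dec_; _⊎-dec_)
open import Algebra.Properties.CommutativeSemigroup +-commutativeSemigroup using (xy∙z≈xz∙y)

-- Charge every call its own work n′² + 1. After step (2) no candidate is adjacent to all
-- candidates on the other side, so the set L of step (3) is nonempty, and by the minimality
-- of w every candidate on the side of L has at least ℓ = |L| non-neighbours. So if n candidates
-- are left after step (2), the branch of step (4)/(5) for the i-th vertex of L has at most
-- n − i − ℓ candidates, and the final call (6) has n − ℓ candidates and either stops at once
-- or has w adjacent to its whole other side, so that its own step (2) removes a vertex.
-- With T(n) = n² + 1 + R(n) bounding a call, the case ℓ = 1 gives the recurrence
-- R(n + 2) = T(n) + (n + 1)² + 1 + R(n) ≈ 2 R(n); its exact solution, a constant times 2^⌈n/2⌉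
-- minus a quadratic, also shows that ℓ > 1 is never worse.

-- The cost recurrence

nodeWork : ℕ → ℕ
nodeWork n = suc (n * n)

-- childrenBound n bounds steps (4)–(6) of a call left with n candidates after step (2), and
-- shrinkingTreeBound n a call on n candidates that stops or whose step (2) removes a vertex.
treeBound childrenBound shrinkingTreeBound : ℕ → ℕ

treeBound n = nodeWork n + childrenBound n

shrinkingTreeBound zero    = 1
shrinkingTreeBound (suc n) = nodeWork (suc n) + childrenBound n

childrenBound 0             = 1
childrenBound 1             = 1
childrenBound (suc (suc n)) = treeBound n + shrinkingTreeBound (suc n)

nodeWork-mono : ∀ {x y} → x ≤ y → nodeWork x ≤ nodeWork y
nodeWork-mono x≤y = s≤s (*-mono-≤ x≤y x≤y)

childrenBound-≤-suc : ∀ n → childrenBound n ≤ childrenBound (suc n)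
childrenBound-≤-suc 0             = ≤-refl
childrenBound-≤-suc 1             = s≤s z≤n
childrenBound-≤-suc (suc (suc n)) =
  +-mono-≤ (+-mono-≤ (nodeWork-mono (n≤1+n n)) ih) (+-mono-≤ (nodeWork-mono (n≤1+n (suc n))) ih)
  where ih = childrenBound-≤-suc n

childrenBound-mono : ∀ {x y} → x ≤ y → childrenBound x ≤ childrenBound y
childrenBound-mono {x} x≤y with m≤n⇒∃[o]m+o≡n x≤y
... | o , refl = go o
  where
  go : ∀ o → childrenBound x ≤ childrenBound (x + o)
  go zero    = ≤-reflexive (cong childrenBound (sym (+-identityʳ x)))
  go (suc o) = ≤-trans (go o) (≤-trans (childrenBound-≤-suc (x + o))
                                        (≤-reflexive (cong childrenBound (sym (+-suc x o)))))

treeBound-mono : ∀ {x y} → x ≤ y → treeBound x ≤ treeBound y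
treeBound-mono x≤y = +-mono-≤ (nodeWork-mono x≤y) (childrenBound-mono x≤y)

nodeWork≤shrinkingTreeBound : ∀ n → nodeWork n ≤ shrinkingTreeBound n
nodeWork≤shrinkingTreeBound zero    = ≤-refl
nodeWork≤shrinkingTreeBound (suc n) = m≤m+n _ _

double : ℕ → ℕ
double zero    = zero
double (suc k) = suc (suc (double k))

double≡k+k : ∀ k → double k ≡ k + k
double≡k+k zero    = refl
double≡k+k (suc k) = cong suc (trans (cong suc (double≡k+k k)) (sym (+-suc k k)))

nodeWork-double : ∀ k → nodeWork (double k) ≡ 4 * (k * k) + 1
nodeWork-double k = trans (cong nodeWork (double≡k+k k)) (identity k)
  where
  identity : ∀ k → suc ((k + k) * (k + k)) ≡ 4 * (k * k) + 1
  identity = solve-∀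

nodeWork-suc-double : ∀ k → nodeWork (suc (double k)) ≡ 4 * (k * k) + 4 * k + 2
nodeWork-suc-double k = trans (cong (nodeWork ∘ suc) (double≡k+k k)) (identity k)
  where
  identity : ∀ k → suc (suc (k + k) * suc (k + k)) ≡ 4 * (k * k) + 4 * k + 2
  identity = solve-∀

data ParityView : ℕ → Set where
  even : ∀ k → ParityView (double k)
  odd  : ∀ k → ParityView (suc (double k))

parityView : ∀ n → ParityView n
parityView zero = even zero
parityView (suc n) with parityView n
... | even k = odd k
... | odd  k = even (suc k)

-- The quadratics q for which c·2^k − q solves the recurrence exactly, on even and odd arguments.
evenSlack oddSlack : ℕ → ℕ
evenSlack k = 8 * (k * k) + 20 * k + 31
oddSlack  k = 8 * (k * k) + 28 * k + 43

childrenBound-doubles : ∀ n c k {s s′} → nodeWork n + nodeWork (suc n) + s′ ≡ 2 * s →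
                        childrenBound n + s ≡ c * 2 ^ k → childrenBound (2 + n) + s′ ≡ c * 2 ^ suc k
childrenBound-doubles n c k {s} {s′} absorbs closed = begin
  (nodeWork n + r) + (nodeWork (suc n) + r) + s′ ≡⟨ regroup (nodeWork n) (nodeWork (suc n)) r s′ ⟩
  (nodeWork n + nodeWork (suc n) + s′) + 2 * r   ≡⟨ cong (_+ 2 * r) absorbs ⟩
  2 * s + 2 * r                                   ≡⟨ sym (*-distribˡ-+ 2 s r) ⟩
  2 * (s + r)                                     ≡⟨ cong (2 *_) (trans (+-comm s r) closed) ⟩
  2 * (c * 2 ^ k)                                 ≡⟨ swap 2 c (2 ^ k) ⟩
  c * 2 ^ suc k                                   ∎
  where
  open ≡-Reasoning
  r = childrenBound n
  regroup : ∀ a b r s′ → (a + r) + (b + r) + s′ ≡ (a + b + s′) + 2 * r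
  regroup = solve-∀
  swap : ∀ a b c → a * (b * c) ≡ b * (a * c)
  swap = solve-∀

childrenBound-even : ∀ k → childrenBound (double k) + evenSlack k ≡ 32 * 2 ^ k
childrenBound-even zero    = refl
childrenBound-even (suc k) = childrenBound-doubles (double k) 32 k absorbs (childrenBound-even k)
  where
  absorbs : nodeWork (double k) + nodeWork (suc (double k)) + evenSlack (suc k) ≡ 2 * evenSlack k
  absorbs = trans (cong₂ (λ a b → a + b + evenSlack (suc k)) (nodeWork-double k) (nodeWork-suc-double k))
                  (identity k)
    where
    identity : ∀ k → 4 * (k * k) + 1 + (4 * (k * k) + 4 * k + 2) + (8 * (suc k * suc k) + 20 * suc k + 31)
                     ≡ 2 * (8 * (k * k) + 20 * k + 31)
    identity = solve-∀

childrenBound-odd : ∀ k → childrenBound (suc (double k)) + oddSlack k ≡ 44 * 2 ^ k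
childrenBound-odd zero    = refl
childrenBound-odd (suc k) = childrenBound-doubles (suc (double k)) 44 k absorbs (childrenBound-odd k)
  where
  absorbs : nodeWork (suc (double k)) + nodeWork (double (suc k)) + oddSlack (suc k) ≡ 2 * oddSlack k
  absorbs = trans (cong₂ (λ a b → a + b + oddSlack (suc k)) (nodeWork-suc-double k) (nodeWork-double (suc k)))
                  (identity k)
    where
    identity : ∀ k → 4 * (k * k) + 4 * k + 2 + (4 * (suc k * suc k) + 1) + (8 * (suc k * suc k) + 28 * suc k + 43)
                     ≡ 2 * (8 * (k * k) + 28 * k + 43)
    identity = solve-∀

≤-by-surplus : ∀ {a b} d → a + d ≡ b → a ≤ b
≤-by-surplus {a} d refl = m≤m+n a d

-- Comparing numbers through their closed forms, without truncated subtraction.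
≤-by-complements : ∀ {a b x y X Y} → a + x ≡ X → b + y ≡ Y → X + y ≤ Y + x → a ≤ b
≤-by-complements {a} {b} {x} {y} {X} {Y} a+x≡X b+y≡Y X+y≤Y+x = +-cancelʳ-≤ (x + y) a b (begin
  a + (x + y) ≡⟨ sym (+-assoc a x y) ⟩
  a + x + y   ≡⟨ cong (_+ y) a+x≡X ⟩
  X + y       ≤⟨ X+y≤Y+x ⟩
  Y + x       ≡⟨ cong (_+ x) (sym b+y≡Y) ⟩
  b + y + x   ≡⟨ +-assoc b y x ⟩
  b + (y + x) ≡⟨ cong (b +_) (+-comm y x) ⟩
  b + (x + y) ∎)
  where open ≤-Reasoning

+-complements : ∀ {a b x y X Y} c → a + x ≡ X → b + y ≡ Y → a + (c + b) + (x + y) ≡ X + Y + c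
+-complements {a} {b} {x} {y} c refl refl = regroup a b c x y
  where
  regroup : ∀ a b c x y → a + (c + b) + (x + y) ≡ a + x + (b + y) + c
  regroup = solve-∀

-- This is why branching on ℓ > 1 vertices is never worse than on one.
childrenBound-absorbs : ∀ z → childrenBound (3 + z) + treeBound z ≤ childrenBound (4 + z)
childrenBound-absorbs z with parityView z
... | even k = ≤-by-complements sum (childrenBound-even (suc (suc k)))
  (≤-by-surplus surplus
    (trans (cong (λ w → 44 * (2 * 2 ^ k) + 32 * 2 ^ k + w + evenSlack (suc (suc k)) + surplus) (nodeWork-double k))
           (balance k (2 ^ k))))
  where
  surplus = 8 * 2 ^ k + (4 * (k * k) + 12 * k + 6)
  sum : childrenBound (suc (double (suc k))) + treeBound (double k) + (oddSlack (suc k) + evenSlack k)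
        ≡ 44 * 2 ^ suc k + 32 * 2 ^ k + nodeWork (double k)
  sum = +-complements {childrenBound (suc (double (suc k)))} {childrenBound (double k)} {oddSlack (suc k)} {evenSlack k}
                      (nodeWork (double k)) (childrenBound-odd (suc k)) (childrenBound-even k)
  balance : ∀ k X → 44 * (2 * X) + 32 * X + (4 * (k * k) + 1) + (8 * (suc (suc k) * suc (suc k)) + 20 * suc (suc k) + 31)
                    + (8 * X + (4 * (k * k) + 12 * k + 6))
                  ≡ 32 * (2 * (2 * X)) + ((8 * (suc k * suc k) + 28 * suc k + 43) + (8 * (k * k) + 20 * k + 31))
  balance = solve-∀
... | odd k = ≤-by-complements sum (childrenBound-odd (suc (suc k)))
  (≤-by-surplus surplus
    (trans (cong (λ w → 32 * (2 * (2 * 2 ^ k)) + 44 * 2 ^ k + w + oddSlack (suc (suc k)) + surplus) (nodeWork-suc-double k))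
           (balance k (2 ^ k))))
  where
  surplus = 4 * 2 ^ k + (4 * (k * k) + 16 * k + 13)
  sum : childrenBound (double (suc (suc k))) + treeBound (suc (double k)) + (evenSlack (suc (suc k)) + oddSlack k)
        ≡ 32 * 2 ^ suc (suc k) + 44 * 2 ^ k + nodeWork (suc (double k))
  sum = +-complements {childrenBound (double (suc (suc k)))} {childrenBound (suc (double k))} {evenSlack (suc (suc k))} {oddSlack k}
                      (nodeWork (suc (double k))) (childrenBound-even (suc (suc k))) (childrenBound-odd k)
  balance : ∀ k X → 32 * (2 * (2 * X)) + 44 * X + (4 * (k * k) + 4 * k + 2) + (8 * (suc (suc k) * suc (suc k)) + 28 * suc (suc k) + 43)
                    + (4 * X + (4 * (k * k) + 16 * k + 13))
                  ≡ 44 * (2 * (2 * X)) + ((8 * (suc (suc k) * suc (suc k)) + 20 * suc (suc k) + 31) + (8 * (k * k) + 28 * k + 43))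
  balance = solve-∀

⌈double/2⌉ : ∀ k → ⌈ double k /2⌉ ≡ k
⌈double/2⌉ zero    = refl
⌈double/2⌉ (suc k) = cong suc (⌈double/2⌉ k)

⌈suc-double/2⌉ : ∀ k → ⌈ suc (double k) /2⌉ ≡ suc k
⌈suc-double/2⌉ zero    = refl
⌈suc-double/2⌉ (suc k) = cong suc (⌈suc-double/2⌉ k)

treeBound≤32*2^⌈n/2⌉ : ∀ n → treeBound n ≤ 32 * 2 ^ ⌈ n /2⌉
treeBound≤32*2^⌈n/2⌉ n with parityView n
... | even k = begin
  nodeWork (double k) + childrenBound (double k) ≤⟨ +-monoˡ-≤ _ work≤slack ⟩
  evenSlack k + childrenBound (double k)        ≡⟨ trans (+-comm (evenSlack k) _) (childrenBound-even k) ⟩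
  32 * 2 ^ k                                    ≡⟨ cong (λ j → 32 * 2 ^ j) (sym (⌈double/2⌉ k)) ⟩
  32 * 2 ^ ⌈ double k /2⌉                       ∎
  where
  open ≤-Reasoning
  work≤slack : nodeWork (double k) ≤ evenSlack k
  work≤slack = ≤-by-surplus surplus (trans (cong (_+ surplus) (nodeWork-double k)) (balance k))
    where
    surplus = 4 * (k * k) + 20 * k + 30
    balance : ∀ k → 4 * (k * k) + 1 + (4 * (k * k) + 20 * k + 30) ≡ 8 * (k * k) + 20 * k + 31
    balance = solve-∀
... | odd k = begin
  nodeWork (suc (double k)) + childrenBound (suc (double k)) ≤⟨ +-monoˡ-≤ _ work≤slack ⟩
  oddSlack k + childrenBound (suc (double k))               ≡⟨ trans (+-comm (oddSlack k) _) (childrenBound-odd k) ⟩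
  44 * 2 ^ k                                                ≤⟨ *-monoˡ-≤ (2 ^ k) (m≤m+n 44 20) ⟩
  64 * 2 ^ k                                                ≡⟨ *-assoc 32 2 (2 ^ k) ⟩
  32 * 2 ^ suc k                                            ≡⟨ cong (λ j → 32 * 2 ^ j) (sym (⌈suc-double/2⌉ k)) ⟩
  32 * 2 ^ ⌈ suc (double k) /2⌉                             ∎
  where
  open ≤-Reasoning
  work≤slack : nodeWork (suc (double k)) ≤ oddSlack k
  work≤slack = ≤-by-surplus surplus (trans (cong (_+ surplus) (nodeWork-suc-double k)) (balance k))
    where
    surplus = 4 * (k * k) + 24 * k + 41
    balance : ∀ k → 4 * (k * k) + 4 * k + 2 + (4 * (k * k) + 24 * k + 41) ≡ 8 * (k * k) + 28 * k + 43
    balance = solve-∀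

-- The first j branches of a branching on ℓ vertices that leaves f candidates: the branch taken
-- i-th from the end has at most f + i − ℓ candidates.
loopBound : ℕ → ℕ → ℕ → ℕ
loopBound f ℓ zero    = 0
loopBound f ℓ (suc j) = treeBound (f + j ∸ ℓ) + loopBound f ℓ j

loopBound-suc : ∀ f ℓ j → loopBound f (suc ℓ) (suc j) ≡ loopBound f ℓ j + treeBound (f ∸ suc ℓ)
loopBound-suc f ℓ zero    = trans (+-identityʳ _) (cong (λ x → treeBound (x ∸ suc ℓ)) (+-identityʳ f))
loopBound-suc f ℓ (suc j) = begin
  treeBound (f + suc j ∸ suc ℓ) + loopBound f (suc ℓ) (suc j)
    ≡⟨ cong₂ _+_ (cong (λ x → treeBound (x ∸ suc ℓ)) (+-suc f j)) (loopBound-suc f ℓ j) ⟩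
  treeBound (f + j ∸ ℓ) + (loopBound f ℓ j + treeBound (f ∸ suc ℓ))
    ≡⟨ sym (+-assoc (treeBound (f + j ∸ ℓ)) _ _) ⟩
  treeBound (f + j ∸ ℓ) + loopBound f ℓ j + treeBound (f ∸ suc ℓ) ∎
  where open ≡-Reasoning

loopBound+shrinkingTreeBound≤childrenBound : ∀ f ℓ → 1 ≤ ℓ → ℓ ≤ f →
                                             loopBound f ℓ ℓ + shrinkingTreeBound f ≤ childrenBound (f + ℓ)
loopBound+shrinkingTreeBound≤childrenBound (suc g) 1 _ _ = ≤-reflexive (begin
  treeBound (suc g + 0 ∸ 1) + 0 + shrinkingTreeBound (suc g)
    ≡⟨ cong (λ x → treeBound x + 0 + shrinkingTreeBound (suc g)) (+-identityʳ g) ⟩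
  treeBound g + 0 + shrinkingTreeBound (suc g)
    ≡⟨ cong (_+ shrinkingTreeBound (suc g)) (+-identityʳ (treeBound g)) ⟩
  childrenBound (2 + g)
    ≡⟨ cong childrenBound (sym (+-comm (suc g) 1)) ⟩
  childrenBound (suc g + 1) ∎)
  where open ≡-Reasoning
loopBound+shrinkingTreeBound≤childrenBound f@(suc (suc g)) (suc ℓ@(suc ℓ′)) _ (s≤s (s≤s ℓ′≤g)) = begin
  loopBound f (suc ℓ) (suc ℓ) + shrinkingTreeBound f
    ≡⟨ cong (_+ shrinkingTreeBound f) (loopBound-suc f ℓ ℓ) ⟩
  loopBound f ℓ ℓ + treeBound (g ∸ ℓ′) + shrinkingTreeBound f
    ≡⟨ xy∙z≈xz∙y (loopBound f ℓ ℓ) _ _ ⟩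
  loopBound f ℓ ℓ + shrinkingTreeBound f + treeBound (g ∸ ℓ′)
    ≤⟨ +-mono-≤ (loopBound+shrinkingTreeBound≤childrenBound f ℓ (s≤s z≤n) (m≤n⇒m≤1+n (s≤s ℓ′≤g)))
                (treeBound-mono (≤-trans (m∸n≤m g ℓ′) (m≤m+n g ℓ′))) ⟩
  childrenBound (f + ℓ) + treeBound (g + ℓ′)
    ≡⟨ cong (λ x → childrenBound x + treeBound (g + ℓ′)) (f+ℓ≡ g ℓ′) ⟩
  childrenBound (3 + (g + ℓ′)) + treeBound (g + ℓ′)
    ≤⟨ childrenBound-absorbs (g + ℓ′) ⟩
  childrenBound (4 + (g + ℓ′))
    ≡⟨ cong childrenBound (sym (f+suc-ℓ≡ g ℓ′)) ⟩
  childrenBound (f + suc ℓ) ∎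
  where
  open ≤-Reasoning
  f+ℓ≡ : ∀ g ℓ′ → suc (suc g) + suc ℓ′ ≡ 3 + (g + ℓ′)
  f+ℓ≡ = solve-∀
  f+suc-ℓ≡ : ∀ g ℓ′ → suc (suc g) + suc (suc ℓ′) ≡ 4 + (g + ℓ′)
  f+suc-ℓ≡ = solve-∀

nodeWork+childrenBound≤shrinkingTreeBound : ∀ {n′ n} → n′ < n → nodeWork n + childrenBound n′ ≤ shrinkingTreeBound n
nodeWork+childrenBound≤shrinkingTreeBound {n = suc n} (s≤s n′≤n) = +-monoʳ-≤ (nodeWork (suc n)) (childrenBound-mono n′≤n)

branchingCost≤childrenBound : ∀ {n f j t₁ t₃} → n ≡ f + j → 1 ≤ j → j ≤ f →
                              t₁ ≤ loopBound f j j → t₃ ≤ shrinkingTreeBound f → t₁ + t₃ ≤ childrenBound n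
branchingCost≤childrenBound {f = f} {j} refl 1≤j j≤f t₁≤ t₃≤ =
  ≤-trans (+-mono-≤ t₁≤ t₃≤) (loopBound+shrinkingTreeBound≤childrenBound f j 1≤j j≤f)

nodeCost-monoʳ : ∀ w {t₁ t₂ t₃ b} → t₁ + t₂ + t₃ ≤ b → w + t₁ + t₂ + t₃ ≤ w + b
nodeCost-monoʳ w {t₁} {t₂} {t₃} le = ≤-trans (≤-reflexive (regroup w t₁ t₂ t₃)) (+-monoʳ-≤ w le)
  where
  regroup : ∀ w t₁ t₂ t₃ → w + t₁ + t₂ + t₃ ≡ w + (t₁ + t₂ + t₃)
  regroup = solve-∀

≤-pred-after-removal : ∀ {a b c n} → a ≡ b + c → a ≡ 0 ⊎ 1 ≤ c → a ≤ suc n → b ≤ n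
≤-pred-after-removal {b = b} refl (inj₁ b+c≡0) _ = ≤-trans (m≤m+n b _) (≤-trans (≤-reflexive b+c≡0) z≤n)
≤-pred-after-removal {b = b} {c} refl (inj₂ 1≤c) b+c≤1+n =
  ≤-pred (≤-trans (subst (_≤ b + c) (+-comm b 1) (+-monoʳ-≤ b 1≤c)) b+c≤1+n)

-- Finite subsets

private variable
  n : ℕ
  x y : Fin n
  p q : Subset n
  f : Fin n → Bool

x∈p─q⇒x∉q : x ∈ p ─ q → x ∉ q
x∈p─q⇒x∉q {p = _ ∷ p} {outside ∷ q} (there x∈p─q) (there x∈q) = x∈p─q⇒x∉q x∈p─q x∈q
x∈p─q⇒x∉q {p = _ ∷ p} {inside  ∷ q} (there x∈p─q) (there x∈q) = x∈p─q⇒x∉q x∈p─q x∈q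

x∈p-y⇒x≢y : x ∈ p - y → x ≢ y
x∈p-y⇒x≢y {y = y} x∈p-y refl = x∈p─q⇒x∉q x∈p-y (x∈⁅x⁆ y)

∣p∩q∣+∣p─q∣≡∣p∣ : ∀ (p q : Subset n) → ∣ p ∩ q ∣ + ∣ p ─ q ∣ ≡ ∣ p ∣
∣p∩q∣+∣p─q∣≡∣p∣ []            []            = refl
∣p∩q∣+∣p─q∣≡∣p∣ (inside  ∷ p) (inside  ∷ q) = cong suc (∣p∩q∣+∣p─q∣≡∣p∣ p q)
∣p∩q∣+∣p─q∣≡∣p∣ (inside  ∷ p) (outside ∷ q) = trans (+-suc _ _) (cong suc (∣p∩q∣+∣p─q∣≡∣p∣ p q))
∣p∩q∣+∣p─q∣≡∣p∣ (outside ∷ p) (inside  ∷ q) = ∣p∩q∣+∣p─q∣≡∣p∣ p q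
∣p∩q∣+∣p─q∣≡∣p∣ (outside ∷ p) (outside ∷ q) = ∣p∩q∣+∣p─q∣≡∣p∣ p q

x∈p⇒1+∣p-x∣≡∣p∣ : x ∈ p → suc ∣ p - x ∣ ≡ ∣ p ∣
x∈p⇒1+∣p-x∣≡∣p∣ {p = inside ∷ p} here         = cong (suc ∘ ∣_∣) (p─⊥≡p p)
x∈p⇒1+∣p-x∣≡∣p∣ {p = inside  ∷ p} (there x∈p) = cong suc (x∈p⇒1+∣p-x∣≡∣p∣ x∈p)
x∈p⇒1+∣p-x∣≡∣p∣ {p = outside ∷ p} (there x∈p) = x∈p⇒1+∣p-x∣≡∣p∣ x∈p

x∈tabulate⇒ : ∀ {f : Fin n → Bool} → x ∈ tabulate f → f x ≡ true
x∈tabulate⇒ {x = x} {f} x∈ = trans (sym (lookup∘tabulate f x)) ([]=⇒lookup x∈)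

⇒x∈tabulate : ∀ {f : Fin n → Bool} → f x ≡ true → x ∈ tabulate f
⇒x∈tabulate {x = x} {f} fx = lookup⇒[]= x (tabulate f) (trans (lookup∘tabulate f x) fx)

-- p ─ tabulate (λ y → lookup p y ∧ f y) is how step (2) removes the elements of p satisfying f.
x∈p─[p∧f]⁻ : x ∈ p ─ tabulate (λ y → lookup p y ∧ f y) → x ∈ p × f x ≡ false
x∈p─[p∧f]⁻ {x = x} {p = p} {f} x∈ = x∈p , ¬-not (x∈p─q⇒x∉q x∈ ∘ ⇒x∈tabulate ∘ selected)
  where
  x∈p = p─q⊆p p _ x∈
  selected : f x ≡ true → lookup p x ∧ f x ≡ true
  selected = cong₂ _∧_ ([]=⇒lookup x∈p)

x∈p─[p∧f]⁺ : x ∈ p → f x ≡ false → x ∈ p ─ tabulate (λ y → lookup p y ∧ f y)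
x∈p─[p∧f]⁺ {x = x} {p = p} {f} x∈p fx≡false =
  x∈p∧x∉q⇒x∈p─q x∈p (λ x∈ → not-¬ (trans (sym (cong (_∧ f x) ([]=⇒lookup x∈p))) (x∈tabulate⇒ x∈)) fx≡false)

x∈p∧x∉p─q⇒x∈q : x ∈ p → x ∉ p ─ q → x ∈ q
x∈p∧x∉p─q⇒x∈q {x = x} {q = q} x∈p x∉p─q with x ∈? q
... | yes x∈q = x∈q
... | no  x∉q = contradiction (x∈p∧x∉q⇒x∈p─q x∈p x∉q) x∉p─q

subᵇ-sound : subᵇ p q ≡ true → p ⊆ q
subᵇ-sound {p = inside  ∷ p} {inside  ∷ q} sub here        = here
subᵇ-sound {p = inside  ∷ p} {inside  ∷ q} sub (there x∈p) = there (subᵇ-sound {p = p} {q} sub x∈p)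
subᵇ-sound {p = outside ∷ p} {inside  ∷ q} sub (there x∈p) = there (subᵇ-sound {p = p} {q} sub x∈p)
subᵇ-sound {p = outside ∷ p} {outside ∷ q} sub (there x∈p) = there (subᵇ-sound {p = p} {q} sub x∈p)

subᵇ-complete : p ⊆ q → subᵇ p q ≡ true
subᵇ-complete {p = []}          {[]}          p⊆q = refl
subᵇ-complete {p = inside  ∷ p} {outside ∷ q} p⊆q with p⊆q here
... | ()
subᵇ-complete {p = inside  ∷ p} {inside  ∷ q} p⊆q = subᵇ-complete (drop-∷-⊆ p⊆q)
subᵇ-complete {p = outside ∷ p} {inside  ∷ q} p⊆q = subᵇ-complete (drop-∷-⊆ p⊆q)
subᵇ-complete {p = outside ∷ p} {outside ∷ q} p⊆q = subᵇ-complete (drop-∷-⊆ p⊆q)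

subᵇ≡false⇒∃ : subᵇ p q ≡ false → ∃[ x ] x ∈ p × x ∉ q
subᵇ≡false⇒∃ {p = []}         {[]}          ()
subᵇ≡false⇒∃ {p = inside ∷ p} {outside ∷ q} _ = zero , here , λ ()
subᵇ≡false⇒∃ {p = inside ∷ p} {inside ∷ q} sub with subᵇ≡false⇒∃ sub
... | x , x∈p , x∉q = suc x , there x∈p , x∉q ∘ drop-there
subᵇ≡false⇒∃ {p = outside ∷ p} {_ ∷ q} sub with subᵇ≡false⇒∃ sub
... | x , x∈p , x∉q = suc x , there x∈p , x∉q ∘ drop-there

∣p∣≡0⇒Empty : ∣ p ∣ ≡ 0 → Empty p
∣p∣≡0⇒Empty ∣p∣≡0 (x , x∈p) with trans (x∈p⇒1+∣p-x∣≡∣p∣ x∈p) ∣p∣≡0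
... | ()

Empty⇒∣p∣≡0 : Empty p → ∣ p ∣ ≡ 0
Empty⇒∣p∣≡0 {n} empty = trans (cong ∣_∣ (Empty-unique empty)) (∣⊥∣≡0 n)

∈-foldl-─⁻ : ∀ (xs : List (Fin n)) → x ∈ foldl _-_ p xs → x ∈ p × ¬ x ∈ₗ xs
∈-foldl-─⁻ []       x∈ = x∈ , λ ()
∈-foldl-─⁻ {p = p} (y ∷ ys) x∈ with ∈-foldl-─⁻ {p = p - y} ys x∈
... | x∈p-y , x∉ys = p─q⊆p p ⁅ y ⁆ x∈p-y , λ { (here refl)  → x∈p-y⇒x≢y x∈p-y refl
                                            ; (there x∈ys) → x∉ys x∈ys }

⊆-tail : ∀ {y} {ys : List (Fin n)} → All.All (y ≢_) ys →
         (∀ {x} → x ∈ₗ y ∷ ys → x ∈ p) → ∀ {x} → x ∈ₗ ys → x ∈ p - y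
⊆-tail y∉ys ys⊆p x∈ys = x∈p∧x≢y⇒x∈p-y (ys⊆p (there x∈ys)) λ { refl → All.lookup y∉ys x∈ys refl }

Unique⇒length≤∣p∣ : ∀ {xs : List (Fin n)} → Unique xs → (∀ {x} → x ∈ₗ xs → x ∈ p) → length xs ≤ ∣ p ∣
Unique⇒length≤∣p∣ {xs = []}     _                 _    = z≤n
Unique⇒length≤∣p∣ {p = p} {xs = y ∷ ys} (y∉ys ∷ unique) ys⊆p =
  subst (suc (length ys) ≤_) (x∈p⇒1+∣p-x∣≡∣p∣ (ys⊆p (here refl)))
        (s≤s (Unique⇒length≤∣p∣ {p = p - y} unique (⊆-tail y∉ys ys⊆p)))

-- The recursion tree of NPC

module NPC {m k : ℕ} (G : BipGraph m k) (p q : ℕ) where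

  N[_] : Fin k → Subset m
  N[_] = NbU G p q
  N⟨_⟩ : Fin m → Subset k
  N⟨_⟩ = NbV G p q
  step₂ : State m k → State m k
  step₂ = step2 G p q

  ∈N[]⇒∈N⟨⟩ : ∀ {u v} → u ∈ N[ v ] → v ∈ N⟨ u ⟩
  ∈N[]⇒∈N⟨⟩ = ⇒x∈tabulate ∘ x∈tabulate⇒

  HasUniversal : State m k → Set
  HasUniversal s = (∃[ u ] u ∈ CU s × CV s ⊆ N⟨ u ⟩) ⊎ (∃[ v ] v ∈ CV s × CU s ⊆ N[ v ])

  empty-stops : ∀ s → size s ≡ 0 → Stop G p q s
  empty-stops _ size≡0 = inj₁ λ u v u∈CU _ → ⊥-elim (∣p∣≡0⇒Empty (m+n≡0⇒m≡0 _ size≡0) (u , u∈CU))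

  step₂-size-≤ : ∀ s → size (step₂ s) ≤ size s
  step₂-size-≤ s = +-mono-≤ (∣p─q∣≤∣p∣ (CU s) _) (∣p─q∣≤∣p∣ (CV s) _)

  step₂-size-< : ∀ s → HasUniversal s → size (step₂ s) < size s
  step₂-size-< s (inj₁ (u , u∈CU , CV⊆N)) =
    +-mono-<-≤ (p∩q≢∅⇒∣p─q∣<∣p∣ (CU s) _ (u , x∈p∩q⁺ (u∈CU , ⇒x∈tabulate moved))) (∣p─q∣≤∣p∣ (CV s) _)
    where
    moved : lookup (CU s) u ∧ subᵇ (CV s) N⟨ u ⟩ ≡ true
    moved = cong₂ _∧_ ([]=⇒lookup u∈CU) (subᵇ-complete CV⊆N)
  step₂-size-< s (inj₂ (v , v∈CV , CU⊆N)) =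
    +-mono-≤-< (∣p─q∣≤∣p∣ (CU s) _) (p∩q≢∅⇒∣p─q∣<∣p∣ (CV s) _ (v , x∈p∩q⁺ (v∈CV , ⇒x∈tabulate moved)))
    where
    moved : lookup (CV s) v ∧ subᵇ (CU (step₂ s)) N[ v ] ≡ true
    moved = cong₂ _∧_ ([]=⇒lookup v∈CV) (subᵇ-complete {p = CU (step₂ s)} (CU⊆N ∘ p─q⊆p (CU s) _))

  step₂-CV-nonUniversal : ∀ s {v} → v ∈ CV (step₂ s) → ∃[ u ] u ∈ CU (step₂ s) × u ∉ N[ v ]
  step₂-CV-nonUniversal s v∈ = subᵇ≡false⇒∃ (proj₂ (x∈p─[p∧f]⁻ v∈))

  step₂-CU-nonUniversal : ∀ s {u} → u ∈ CU (step₂ s) → ∃[ v ] v ∈ CV (step₂ s) × v ∉ N⟨ u ⟩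
  step₂-CU-nonUniversal s {u} u∈ with subᵇ≡false⇒∃ (proj₂ (x∈p─[p∧f]⁻ u∈))
  ... | v , v∈CV , v∉N = v , x∈p─[p∧f]⁺ {f = λ v → subᵇ (CU (step₂ s)) N[ v ]} v∈CV v-stays , v∉N
    where
    -- v would only be moved if it were adjacent to all of the new C_U, which contains u
    v-stays : subᵇ (CU (step₂ s)) N[ v ] ≡ false
    v-stays = ¬-not (v∉N ∘ ∈N[]⇒∈N⟨⟩ ∘ (λ sub → subᵇ-sound {p = CU (step₂ s)} sub u∈))

  nonU-nonempty : ∀ s {w} → InC G p q (step₂ s) w → Nonempty (nonU G p q (step₂ s) w)
  nonU-nonempty s {inj₁ u} u∈ = u , x∈p∧x∉q⇒x∈p─q u∈ ∉⊥
  nonU-nonempty s {inj₂ v} v∈ with step₂-CV-nonUniversal s v∈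
  ... | u , u∈ , u∉N = u , x∈p∧x∉q⇒x∈p─q u∈ u∉N

  nonV-nonempty : ∀ s {w} → InC G p q (step₂ s) w → Nonempty (nonV G p q (step₂ s) w)
  nonV-nonempty s {inj₁ u} u∈ with step₂-CU-nonUniversal s u∈
  ... | v , v∈ , v∉N = v , x∈p∧x∉q⇒x∈p─q v∈ v∉N
  nonV-nonempty s {inj₂ v} v∈ = v , x∈p∧x∉q⇒x∈p─q v∈ ∉⊥

  record BranchOnU (s : State m k) (L : Subset m) : Set where
    field
      nonempty      : Nonempty L
      L⊆CU          : L ⊆ CU s
      fewNeighbours : ∀ {u} → u ∈ CU s → ∣ CV s ∩ N⟨ u ⟩ ∣ + ∣ L ∣ ≤ ∣ CV s ∣
      remainder     : ∀ {A} → A ⊆ CU s ─ L → Stop G p q (record s { CU = A }) ⊎ HasUniversal (record s { CU = A })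

  record BranchOnV (s : State m k) (L : Subset k) : Set where
    field
      nonempty      : Nonempty L
      L⊆CV          : L ⊆ CV s
      fewNeighbours : ∀ {v} → v ∈ CV s → ∣ CU s ∩ N[ v ] ∣ + ∣ L ∣ ≤ ∣ CU s ∣
      remainder     : ∀ {B} → B ⊆ CV s ─ L → Stop G p q (record s { CV = B }) ⊎ HasUniversal (record s { CV = B })

  data Branching (s : State m k) : Subset m → Subset k → Set where
    noCandidates : size s ≡ 0 → Branching s ⊥ ⊥
    onU          : ∀ {L} → BranchOnU s L → Branching s L ⊥
    onV          : ∀ {L} → BranchOnV s L → Branching s ⊥ L

  private
    Minimal : State m k → Vertex m k → Set
    Minimal s w = ∀ w′ → InC G p q s w′ → key G p q s w ≤ key G p q s w′

  branchOnU : ∀ s {w} → InC G p q (step₂ s) w → Minimal (step₂ s) w →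
              (∣ nonU G p q (step₂ s) w ∣ ≤ᵇ ∣ nonV G p q (step₂ s) w ∣) ≡ true →
              BranchOnU (step₂ s) (nonU G p q (step₂ s) w)
  branchOnU s {w} w∈ minimal U≤V = record
    { nonempty      = nonU-nonempty s w∈
    ; L⊆CU          = p─q⊆p _ _
    ; fewNeighbours = few
    ; remainder     = rest w∈
    }
    where
    s₂ = step₂ s
    ∣L∣≡key : ∣ nonU G p q s₂ w ∣ ≡ key G p q s₂ w
    ∣L∣≡key = sym (m≤n⇒m⊓n≡m (≤ᵇ⇒≤ _ _ (subst T (sym U≤V) _)))
    few : ∀ {u} → u ∈ CU s₂ → ∣ CV s₂ ∩ N⟨ u ⟩ ∣ + ∣ nonU G p q s₂ w ∣ ≤ ∣ CV s₂ ∣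
    few {u} u∈ = ≤-trans (+-monoʳ-≤ _ (≤-trans (≤-reflexive ∣L∣≡key) (≤-trans (minimal (inj₁ u) u∈) (m⊓n≤n _ _))))
                         (≤-reflexive (∣p∩q∣+∣p─q∣≡∣p∣ (CV s₂) N⟨ u ⟩))
    rest : ∀ {w} → InC G p q s₂ w → ∀ {A} → A ⊆ CU s₂ ─ nonU G p q s₂ w →
           Stop G p q (record s₂ { CU = A }) ⊎ HasUniversal (record s₂ { CU = A })
    rest {inj₁ _} _  A⊆ = inj₁ (inj₁ λ u v u∈A _ →
      ⊥-elim (x∈p─q⇒x∉q (A⊆ u∈A) (x∈p∧x∉q⇒x∈p─q (p─q⊆p _ _ (A⊆ u∈A)) ∉⊥)))
    rest {inj₂ v} v∈ A⊆ = inj₂ (inj₂ (v , v∈ , λ u∈A → x∈p∧x∉p─q⇒x∈q (p─q⊆p _ _ (A⊆ u∈A)) (x∈p─q⇒x∉q (A⊆ u∈A))))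

  branchOnV : ∀ s {w} → InC G p q (step₂ s) w → Minimal (step₂ s) w →
              (∣ nonU G p q (step₂ s) w ∣ ≤ᵇ ∣ nonV G p q (step₂ s) w ∣) ≡ false →
              BranchOnV (step₂ s) (nonV G p q (step₂ s) w)
  branchOnV s {w} w∈ minimal V<U = record
    { nonempty      = nonV-nonempty s w∈
    ; L⊆CV          = p─q⊆p _ _
    ; fewNeighbours = few
    ; remainder     = rest w∈
    }
    where
    s₂ = step₂ s
    ∣L∣≡key : ∣ nonV G p q s₂ w ∣ ≡ key G p q s₂ w
    ∣L∣≡key = sym (m≥n⇒m⊓n≡n (<⇒≤ (≰⇒> λ U≤V → subst T V<U (≤⇒≤ᵇ U≤V))))
    few : ∀ {v} → v ∈ CV s₂ → ∣ CU s₂ ∩ N[ v ] ∣ + ∣ nonV G p q s₂ w ∣ ≤ ∣ CU s₂ ∣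
    few {v} v∈ = ≤-trans (+-monoʳ-≤ _ (≤-trans (≤-reflexive ∣L∣≡key) (≤-trans (minimal (inj₂ v) v∈) (m⊓n≤m _ _))))
                         (≤-reflexive (∣p∩q∣+∣p─q∣≡∣p∣ (CU s₂) N[ v ]))
    rest : ∀ {w} → InC G p q s₂ w → ∀ {B} → B ⊆ CV s₂ ─ nonV G p q s₂ w →
           Stop G p q (record s₂ { CV = B }) ⊎ HasUniversal (record s₂ { CV = B })
    rest {inj₂ _} _  B⊆ = inj₁ (inj₁ λ u v _ v∈B →
      ⊥-elim (x∈p─q⇒x∉q (B⊆ v∈B) (x∈p∧x∉q⇒x∈p─q (p─q⊆p _ _ (B⊆ v∈B)) ∉⊥)))
    rest {inj₁ u} u∈ B⊆ = inj₂ (inj₁ (u , u∈ , λ v∈B → x∈p∧x∉p─q⇒x∈q (p─q⊆p _ _ (B⊆ v∈B)) (x∈p─q⇒x∉q (B⊆ v∈B))))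

  branching : ∀ s {LU LV} → Partition G p q (step₂ s) LU LV → Branching (step₂ s) LU LV
  branching s (none noCandidate) = noCandidates (cong₂ _+_
    (Empty⇒∣p∣≡0 λ (u , u∈) → noCandidate (inj₁ u) u∈)
    (Empty⇒∣p∣≡0 λ (v , v∈) → noCandidate (inj₂ v) v∈))
  branching s (pick w w∈ minimal) with ∣ nonU G p q (step₂ s) w ∣ ≤ᵇ ∣ nonV G p q (step₂ s) w ∣ in U≤V
  ... | true  = onU (branchOnU s w∈ minimal U≤V)
  ... | false = onV (branchOnV s w∈ minimal U≤V)

  size-removeU : ∀ (s : State m k) {u} → u ∈ CU s → size s ≡ suc (size (record s { CU = CU s - u }))
  size-removeU s {u} u∈ = cong (_+ ∣ CV s ∣) (sym (x∈p⇒1+∣p-x∣≡∣p∣ {p = CU s} u∈))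

  size-removeV : ∀ (s : State m k) {v} → v ∈ CV s → size s ≡ suc (size (record s { CV = CV s - v }))
  size-removeV s v∈ = trans (cong (∣ CU s ∣ +_) (sym (x∈p⇒1+∣p-x∣≡∣p∣ v∈))) (+-suc _ _)

  loopU-shape : ∀ {s : State m k} {us s′ t} → LoopU G p q s us s′ t → Unique us → (∀ {u} → u ∈ₗ us → u ∈ CU s) →
                s′ ≡ record s { CU = foldl _-_ (CU s) us } × size s ≡ size s′ + length us
  loopU-shape {s} [] _ _ = refl , sym (+-identityʳ (size s))
  loopU-shape {s} (_∷_ {u = u} {us} {s′} _ rest) (u∉us ∷ unique) us⊆ with loopU-shape rest unique (⊆-tail u∉us us⊆)
  ... | s′≡ , size≡ = s′≡ , trans (size-removeU s (us⊆ (here refl))) (trans (cong suc size≡) (sym (+-suc (size s′) _)))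

  loopV-shape : ∀ {s : State m k} {vs s′ t} → LoopV G p q s vs s′ t → Unique vs → (∀ {v} → v ∈ₗ vs → v ∈ CV s) →
                s′ ≡ record s { CV = foldl _-_ (CV s) vs } × size s ≡ size s′ + length vs
  loopV-shape {s} [] _ _ = refl , sym (+-identityʳ (size s))
  loopV-shape {s} (_∷_ {v = v} {vs} {s′} _ rest) (v∉vs ∷ unique) vs⊆ with loopV-shape rest unique (⊆-tail v∉vs vs⊆)
  ... | s′≡ , size≡ = s′≡ , trans (size-removeV s (vs⊆ (here refl))) (trans (cong suc size≡) (sym (+-suc (size s′) _)))

  loopU-[] : ∀ {s : State m k} {us s′ t} → Enumerates G p q us ⊥ → LoopU G p q s us s′ t → s′ ≡ s × t ≡ 0
  loopU-[] _ [] = refl , refl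
  loopU-[] (_ , us⇔⊥) (_∷_ {u = u} _ _) = ⊥-elim (∉⊥ (Equivalence.to (us⇔⊥ u) (here refl)))

  loopV-[] : ∀ {s : State m k} {vs s′ t} → Enumerates G p q vs ⊥ → LoopV G p q s vs s′ t → s′ ≡ s × t ≡ 0
  loopV-[] _ [] = refl , refl
  loopV-[] (_ , vs⇔⊥) (_∷_ {v = v} _ _) = ⊥-elim (∉⊥ (Equivalence.to (vs⇔⊥ v) (here refl)))

  mutual
    cost≤treeBound : ∀ {s t} → Run G p q s t → t ≤ treeBound (size s)
    cost≤treeBound {s} (leaf _) = m≤m+n (work s) _
    cost≤treeBound {s} (node _ part enU enV loopU loopV last) =
      ≤-trans (nodeCost-monoʳ (work s) (childrenCost≤childrenBound s part enU enV loopU loopV last))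
              (+-monoʳ-≤ (work s) (childrenBound-mono (step₂-size-≤ s)))

    cost≤shrinkingTreeBound : ∀ {s t} → Run G p q s t → Stop G p q s ⊎ HasUniversal s → t ≤ shrinkingTreeBound (size s)
    cost≤shrinkingTreeBound {s} (leaf _) _ = nodeWork≤shrinkingTreeBound (size s)
    cost≤shrinkingTreeBound (node ¬stop _ _ _ _ _ _) (inj₁ stop) = contradiction stop ¬stop
    cost≤shrinkingTreeBound {s} (node _ part enU enV loopU loopV last) (inj₂ universal) =
      ≤-trans (nodeCost-monoʳ (work s) (childrenCost≤childrenBound s part enU enV loopU loopV last))
              (nodeWork+childrenBound≤shrinkingTreeBound (step₂-size-< s universal))

    childrenCost≤childrenBound : ∀ s {LU LV ordU ordV s₃ s₄ t₁ t₂ t₃} →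
      Partition G p q (step₂ s) LU LV → Enumerates G p q ordU LU → Enumerates G p q ordV LV →
      LoopU G p q (step₂ s) ordU s₃ t₁ → LoopV G p q s₃ ordV s₄ t₂ → Run G p q s₄ t₃ →
      t₁ + t₂ + t₃ ≤ childrenBound (size (step₂ s))
    childrenCost≤childrenBound s part enU enV loopU loopV last with branching s part
    ... | noCandidates size≡0 with loopU-[] enU loopU | loopV-[] enV loopV
    ...   | refl , refl | refl , refl =
      ≤-trans (cost≤shrinkingTreeBound last (inj₁ (empty-stops (step₂ s) size≡0)))
              (≤-reflexive (trans (cong shrinkingTreeBound size≡0) (cong childrenBound (sym size≡0))))
    childrenCost≤childrenBound s {t₁ = t₁} {t₃ = t₃} part enU enV loopU loopV last | onU b
      with loopV-[] enV loopV
    ... | refl , refl =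
      ≤-trans (≤-reflexive (cong (_+ t₃) (+-identityʳ t₁))) (branchOnU-cost≤childrenBound s b enU loopU last)
    childrenCost≤childrenBound s part enU enV loopU loopV last | onV b with loopU-[] enU loopU
    ... | refl , refl = branchOnV-cost≤childrenBound s b enV loopV last

    branchOnU-cost≤childrenBound : ∀ s {L us s₃ t₁ t₃} → BranchOnU (step₂ s) L → Enumerates G p q us L →
      LoopU G p q (step₂ s) us s₃ t₁ → Run G p q s₃ t₃ → t₁ + t₃ ≤ childrenBound (size (step₂ s))
    branchOnU-cost≤childrenBound s {L} {us} b (unique , us⇔L) loop last
      with loopU-shape loop unique (BranchOnU.L⊆CU b ∘ Equivalence.to (us⇔L _))
    ... | refl , size≡ = branchingCost≤childrenBound size≡ 1≤j j≤f
      (loopU-cost≤loopBound j loop unique us⊆CU (λ u∈ → ≤-trans (+-monoʳ-≤ _ j≤∣L∣) (fewNeighbours (us⊆CU u∈))))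
      (cost≤shrinkingTreeBound last (remainder λ x∈ → let x∈CU , x∉us = ∈-foldl-─⁻ us x∈ in
                                                   x∈p∧x∉q⇒x∈p─q x∈CU (x∉us ∘ Equivalence.from (us⇔L _))))
      where
      open BranchOnU b
      s₂ = step₂ s
      us⊆CU : ∀ {u} → u ∈ₗ us → u ∈ CU s₂
      us⊆CU = L⊆CU ∘ Equivalence.to (us⇔L _)
      j = length us
      j≤∣L∣ : j ≤ ∣ L ∣
      j≤∣L∣ = Unique⇒length≤∣p∣ unique (Equivalence.to (us⇔L _))
      x∈us = Equivalence.from (us⇔L _) (proj₂ nonempty)
      1≤j : 1 ≤ j
      1≤j = ∈-length x∈us
      j≤f : j ≤ size (record s₂ { CU = foldl _-_ (CU s₂) us })
      j≤f = ≤-trans (m+n≤o⇒n≤o _ (≤-trans (+-monoʳ-≤ _ j≤∣L∣) (fewNeighbours (us⊆CU x∈us)))) (m≤n+m _ _)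

    branchOnV-cost≤childrenBound : ∀ s {L vs s₄ t₂ t₃} → BranchOnV (step₂ s) L → Enumerates G p q vs L →
      LoopV G p q (step₂ s) vs s₄ t₂ → Run G p q s₄ t₃ → t₂ + t₃ ≤ childrenBound (size (step₂ s))
    branchOnV-cost≤childrenBound s {L} {vs} b (unique , vs⇔L) loop last
      with loopV-shape loop unique (BranchOnV.L⊆CV b ∘ Equivalence.to (vs⇔L _))
    ... | refl , size≡ = branchingCost≤childrenBound size≡ 1≤j j≤f
      (loopV-cost≤loopBound j loop unique vs⊆CV (λ v∈ → ≤-trans (+-monoʳ-≤ _ j≤∣L∣) (fewNeighbours (vs⊆CV v∈))))
      (cost≤shrinkingTreeBound last (remainder λ x∈ → let x∈CV , x∉vs = ∈-foldl-─⁻ vs x∈ in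
                                                   x∈p∧x∉q⇒x∈p─q x∈CV (x∉vs ∘ Equivalence.from (vs⇔L _))))
      where
      open BranchOnV b
      s₂ = step₂ s
      vs⊆CV : ∀ {v} → v ∈ₗ vs → v ∈ CV s₂
      vs⊆CV = L⊆CV ∘ Equivalence.to (vs⇔L _)
      j = length vs
      j≤∣L∣ : j ≤ ∣ L ∣
      j≤∣L∣ = Unique⇒length≤∣p∣ unique (Equivalence.to (vs⇔L _))
      x∈vs = Equivalence.from (vs⇔L _) (proj₂ nonempty)
      1≤j : 1 ≤ j
      1≤j = ∈-length x∈vs
      j≤f : j ≤ size (record s₂ { CV = foldl _-_ (CV s₂) vs })
      j≤f = ≤-trans (m+n≤o⇒n≤o _ (≤-trans (+-monoʳ-≤ _ j≤∣L∣) (fewNeighbours (vs⊆CV x∈vs)))) (m≤m+n _ _)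

    loopU-cost≤loopBound : ∀ ℓ {s us s′ t} → LoopU G p q s us s′ t → Unique us →
      (∀ {u} → u ∈ₗ us → u ∈ CU s) → (∀ {u} → u ∈ₗ us → ∣ CV s ∩ N⟨ u ⟩ ∣ + ℓ ≤ ∣ CV s ∣) →
      t ≤ loopBound (size s′) ℓ (length us)
    loopU-cost≤loopBound ℓ [] _ _ _ = z≤n
    loopU-cost≤loopBound ℓ {s} (_∷_ {u = u} {us} {s′} child rest) (u∉us ∷ unique) us⊆ few =
      +-mono-≤ (≤-trans (cost≤treeBound child) (treeBound-mono child≤))
               (loopU-cost≤loopBound ℓ rest unique (⊆-tail u∉us us⊆) (few ∘ there))
      where
      child+ℓ≤ : ∣ CU s - u ∣ + ∣ CV s ∩ N⟨ u ⟩ ∣ + ℓ ≤ size s′ + length us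
      child+ℓ≤ = begin
        ∣ CU s - u ∣ + ∣ CV s ∩ N⟨ u ⟩ ∣ + ℓ   ≡⟨ +-assoc ∣ CU s - u ∣ _ ℓ ⟩
        ∣ CU s - u ∣ + (∣ CV s ∩ N⟨ u ⟩ ∣ + ℓ) ≤⟨ +-monoʳ-≤ ∣ CU s - u ∣ (few (here refl)) ⟩
        ∣ CU s - u ∣ + ∣ CV s ∣                ≡⟨ proj₂ (loopU-shape rest unique (⊆-tail u∉us us⊆)) ⟩
        size s′ + length us                   ∎
        where open ≤-Reasoning
      child≤ : ∣ CU s - u ∣ + ∣ CV s ∩ N⟨ u ⟩ ∣ ≤ size s′ + length us ∸ ℓ
      child≤ = m+n≤o⇒m≤o∸n (∣ CU s - u ∣ + ∣ CV s ∩ N⟨ u ⟩ ∣) child+ℓ≤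

    loopV-cost≤loopBound : ∀ ℓ {s vs s′ t} → LoopV G p q s vs s′ t → Unique vs →
      (∀ {v} → v ∈ₗ vs → v ∈ CV s) → (∀ {v} → v ∈ₗ vs → ∣ CU s ∩ N[ v ] ∣ + ℓ ≤ ∣ CU s ∣) →
      t ≤ loopBound (size s′) ℓ (length vs)
    loopV-cost≤loopBound ℓ [] _ _ _ = z≤n
    loopV-cost≤loopBound ℓ {s} (_∷_ {v = v} {vs} {s′} child rest) (v∉vs ∷ unique) vs⊆ few =
      +-mono-≤ (≤-trans (cost≤treeBound child) (treeBound-mono child≤))
               (loopV-cost≤loopBound ℓ rest unique (⊆-tail v∉vs vs⊆) (few ∘ there))
      where
      child+ℓ≤ : ∣ CU s ∩ N[ v ] ∣ + ∣ CV s - v ∣ + ℓ ≤ size s′ + length vs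
      child+ℓ≤ = begin
        ∣ CU s ∩ N[ v ] ∣ + ∣ CV s - v ∣ + ℓ   ≡⟨ xy∙z≈xz∙y ∣ CU s ∩ N[ v ] ∣ _ ℓ ⟩
        ∣ CU s ∩ N[ v ] ∣ + ℓ + ∣ CV s - v ∣   ≤⟨ +-monoˡ-≤ ∣ CV s - v ∣ (few (here refl)) ⟩
        ∣ CU s ∣ + ∣ CV s - v ∣                ≡⟨ proj₂ (loopV-shape rest unique (⊆-tail v∉vs vs⊆)) ⟩
        size s′ + length vs                   ∎
        where open ≤-Reasoning
      child≤ : ∣ CU s ∩ N[ v ] ∣ + ∣ CV s - v ∣ ≤ size s′ + length vs ∸ ℓ
      child≤ = m+n≤o⇒m≤o∸n (∣ CU s ∩ N[ v ] ∣ + ∣ CV s - v ∣) child+ℓ≤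

  stop? : ∀ s → Dec (Stop G p q s)
  stop? s = noEdge? ⊎-dec (∣ HU s ∣ Nat.≟ p ⊎-dec ∣ HV s ∣ Nat.≟ q)
    where
    noEdge? : Dec (NoEdge G p q (CU s) (CV s))
    noEdge? = all? λ u → all? λ v → (u ∈? CU s) →-dec (v ∈? CV s) →-dec (adj G u v Bool.≟ false)

  enumerate : ∀ {n} (A : Subset n) → ∃[ xs ] Enumerates G p q xs A
  enumerate {n} A = filter (_∈? A) (allFin n) , filter⁺ (_∈? A) (allFin⁺ n) ,
                    λ x → mk⇔ (proj₂ ∘ ∈-filter⁻ (_∈? A) {xs = allFin n}) (∈-filter⁺ (_∈? A) (∈-allFin x))

  candidates : State m k → List (Vertex m k)
  candidates s = map inj₁ (proj₁ (enumerate (CU s))) ++ map inj₂ (proj₁ (enumerate (CV s)))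

  InC⇒∈candidates : ∀ s {w} → InC G p q s w → w ∈ₗ candidates s
  InC⇒∈candidates s {inj₁ u} u∈ = ∈-++⁺ˡ (∈-map⁺ inj₁ (Equivalence.from (proj₂ (proj₂ (enumerate (CU s))) u) u∈))
  InC⇒∈candidates s {inj₂ v} v∈ = ∈-++⁺ʳ _ (∈-map⁺ inj₂ (Equivalence.from (proj₂ (proj₂ (enumerate (CV s))) v) v∈))

  ∈candidates⇒InC : ∀ s {w} → w ∈ₗ candidates s → InC G p q s w
  ∈candidates⇒InC s w∈ with ∈-++⁻ (map inj₁ (proj₁ (enumerate (CU s)))) w∈
  ... | inj₁ w∈U with ∈-map⁻ inj₁ w∈U
  ...   | u , u∈ , refl = Equivalence.to (proj₂ (proj₂ (enumerate (CU s))) u) u∈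
  ∈candidates⇒InC s w∈ | inj₂ w∈V with ∈-map⁻ inj₂ w∈V
  ...   | v , v∈ , refl = Equivalence.to (proj₂ (proj₂ (enumerate (CV s))) v) v∈

  partition : ∀ s → ∃[ LU ] ∃[ LV ] Partition G p q s LU LV
  partition s with candidates s in eq
  ... | [] = ⊥ , ⊥ , none λ w w∈ → ¬Any[] (subst (w ∈ₗ_) eq (InC⇒∈candidates s w∈))
  ... | w ∷ ws = _ , _ , pick w* (∈candidates⇒InC s (subst (w* ∈ₗ_) (sym eq) w*∈)) minimal
    where
    w* = argmin (key G p q s) w ws
    w*∈ : w* ∈ₗ w ∷ ws
    w*∈ with argmin-sel (key G p q s) w ws
    ... | inj₁ w*≡w  = here w*≡w
    ... | inj₂ w*∈ws = there w*∈ws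
    minimal : Minimal s w*
    minimal w′ w′∈ with subst (w′ ∈ₗ_) eq (InC⇒∈candidates s w′∈)
    ... | here refl    = f[argmin]≤f[⊤] {f = key G p q s} w ws
    ... | there w′∈ws = All.lookup (f[argmin]≤f[xs] {f = key G p q s} w ws) w′∈ws

  Partition⇒LU⊆CU : ∀ s {LU LV} → Partition G p q (step₂ s) LU LV → LU ⊆ CU (step₂ s)
  Partition⇒LU⊆CU s part with branching s part
  ... | noCandidates _ = ⊥⊆
  ... | onU b          = BranchOnU.L⊆CU b
  ... | onV _          = ⊥⊆

  Partition⇒LV⊆CV : ∀ s {LU LV} → Partition G p q (step₂ s) LU LV → LV ⊆ CV (step₂ s)
  Partition⇒LV⊆CV s part with branching s part
  ... | noCandidates _ = ⊥⊆
  ... | onU _          = ⊥⊆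
  ... | onV b          = BranchOnV.L⊆CV b

  progress : ∀ s {LU LV ordU ordV} → Partition G p q (step₂ s) LU LV →
             Enumerates G p q ordU LU → Enumerates G p q ordV LV →
             size (step₂ s) ≡ 0 ⊎ 1 ≤ length ordV + length ordU
  progress s part (_ , ordU⇔) (_ , ordV⇔) with branching s part
  ... | noCandidates size≡0 = inj₁ size≡0
  ... | onU b = inj₂ (≤-trans (∈-length (Equivalence.from (ordU⇔ _) (proj₂ (BranchOnU.nonempty b)))) (m≤n+m _ _))
  ... | onV b = inj₂ (≤-trans (∈-length (Equivalence.from (ordV⇔ _) (proj₂ (BranchOnV.nonempty b)))) (m≤m+n _ _))

  Runs : ℕ → Set
  Runs n = ∀ s → size s ≤ n → ∃[ t ] Run G p q s t

  buildLoopU : ∀ {n s us} → Runs n → Unique us → (∀ {u} → u ∈ₗ us → u ∈ CU s) → size s ≤ suc n →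
               ∃[ s′ ] ∃[ t ] LoopU G p q s us s′ t
  buildLoopU {us = []} _ _ _ _ = _ , _ , []
  buildLoopU {n} {s} {u ∷ us} run (u∉us ∷ unique) us⊆ size≤
    with run _ child≤ | buildLoopU run unique (⊆-tail u∉us us⊆) (m≤n⇒m≤1+n next≤)
    where
    next≤ : size (record s { CU = CU s - u }) ≤ n
    next≤ = ≤-pred (subst (_≤ suc n) (size-removeU s (us⊆ (here refl))) size≤)
    child≤ : ∣ CU s - u ∣ + ∣ CV s ∩ N⟨ u ⟩ ∣ ≤ n
    child≤ = ≤-trans (+-monoʳ-≤ _ (∣p∩q∣≤∣p∣ (CV s) _)) next≤
  ... | t , child | s′ , t′ , rest = s′ , t + t′ , child ∷ rest

  buildLoopV : ∀ {n s vs} → Runs n → Unique vs → (∀ {v} → v ∈ₗ vs → v ∈ CV s) → size s ≤ suc n →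
               ∃[ s′ ] ∃[ t ] LoopV G p q s vs s′ t
  buildLoopV {vs = []} _ _ _ _ = _ , _ , []
  buildLoopV {n} {s} {v ∷ vs} run (v∉vs ∷ unique) vs⊆ size≤
    with run _ child≤ | buildLoopV run unique (⊆-tail v∉vs vs⊆) (m≤n⇒m≤1+n next≤)
    where
    next≤ : size (record s { CV = CV s - v }) ≤ n
    next≤ = ≤-pred (subst (_≤ suc n) (size-removeV s (vs⊆ (here refl))) size≤)
    child≤ : ∣ CU s ∩ N[ v ] ∣ + ∣ CV s - v ∣ ≤ n
    child≤ = ≤-trans (+-monoˡ-≤ _ (∣p∩q∣≤∣p∣ (CU s) _)) next≤
  ... | t , child | s′ , t′ , rest = s′ , t + t′ , child ∷ rest

  run : ∀ n → Runs n
  run n s size≤n with stop? s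
  ... | yes stop = _ , leaf stop
  run zero s size≤0 | no ¬stop = contradiction (empty-stops s (n≤0⇒n≡0 size≤0)) ¬stop
  run (suc n) s size≤ | no ¬stop = _ , node ¬stop part enU enV loopU loopV (proj₂ (run n s₄ s₄≤n))
    where
    s₂ = step₂ s
    s₂≤ : size s₂ ≤ suc n
    s₂≤ = ≤-trans (step₂-size-≤ s) size≤
    LU = proj₁ (partition s₂)
    LV = proj₁ (proj₂ (partition s₂))
    part = proj₂ (proj₂ (partition s₂))
    ordU = proj₁ (enumerate LU)
    enU = proj₂ (enumerate LU)
    ordV = proj₁ (enumerate LV)
    enV = proj₂ (enumerate LV)
    ordU⊆ : ∀ {u} → u ∈ₗ ordU → u ∈ CU s₂
    ordU⊆ = Partition⇒LU⊆CU s part ∘ Equivalence.to (proj₂ enU _)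
    builtU = buildLoopU (run n) (proj₁ enU) ordU⊆ s₂≤
    s₃ = proj₁ builtU
    loopU = proj₂ (proj₂ builtU)
    shapeU = loopU-shape loopU (proj₁ enU) ordU⊆
    ordV⊆ : ∀ {v} → v ∈ₗ ordV → v ∈ CV s₃
    ordV⊆ = subst (λ s′ → _ ∈ CV s′) (sym (proj₁ shapeU)) ∘ Partition⇒LV⊆CV s part ∘ Equivalence.to (proj₂ enV _)
    builtV = buildLoopV (run n) (proj₁ enV) ordV⊆ (≤-trans (m≤m+n _ _) (≤-trans (≤-reflexive (sym (proj₂ shapeU))) s₂≤))
    s₄ = proj₁ builtV
    loopV = proj₂ (proj₂ builtV)
    size₂≡ : size s₂ ≡ size s₄ + (length ordV + length ordU)
    size₂≡ = trans (proj₂ shapeU) (trans (cong (_+ length ordU) (proj₂ (loopV-shape loopV (proj₁ enV) ordV⊆)))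
                                         (+-assoc (size s₄) (length ordV) (length ordU)))
    s₄≤n : size s₄ ≤ n
    s₄≤n = ≤-pred-after-removal size₂≡ (progress s part enU enV) s₂≤


theorem4p6 : ∃[ c ] ((m k : ℕ) (G : BipGraph m k) (p q : ℕ) → 1 ≤ p → 1 ≤ q →
    (s : State m k) →
    (∃[ t ] Run G p q s t) ×
    ((t : ℕ) → Run G p q s t → t ≤ c * 2 ^ ⌈ size s /2⌉))
-- p and q only decide when a call stops.
theorem4p6 = 32 , λ m k G p q _ _ s →
  NPC.run G p q (size s) s ≤-refl ,
  λ _ r → ≤-trans (NPC.cost≤treeBound G p q r) (treeBound≤32*2^⌈n/2⌉ (size s))
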